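{- Let $k$ be a positive integer. For all integers $\ell_o,m,n\geq 0$, \[ O_{k,k}(\ell_o,m,n)=P_{k}(\ell_o,m+(k-1)\ell_o,n). \]
   Context: An overpartition is a partition in which the first occurrence of each part size may be overlined. A $(k,k)$-overpartition is an overpartition in which only parts divisible by $k$ may be overlined. A $k$-partition is a partition in which, for each part size occurring at least $k$ times, the $k$-th occurrence of that part may (optionally) be overlined. $O_{k,k}(\ell_o,m,n)$ denotes the number of $(k,k)$-overpartitions of $n$ with exactly $\ell_o$ overlined parts and exactly $m$ parts, and $P_k(\ell_o,m,n)$ denotes the number of $k$-partitions of $n$ with exactly $\ell_o$ overlined parts and exactly $m$ parts. -}

module Defs where

open import Data.Nat using (ℕ; zero; suc; _+_; _*_; _≤ᵇ_; _≡ᵇ_)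
open import Data.Nat.Divisibility using (_∣?_)
open import Data.Bool using (Bool; true; false; _∧_; _∨_; not; if_then_else_)
open import Data.Product using (_×_; _,_)
open import Data.List using (List; []; _∷_; length; filterᵇ; concatMap; map; upTo)
open import Data.Vec using (Vec; []; _∷_)
open import Relation.Nullary.Decidable using (does)

-- Since
-- at most one occurrence of each part size may be overlined (the first one
-- for overpartitions, the k-th one for k-partitions), a marked partition
-- with all parts ≤ len is encoded as a vector of length len whose entry at
-- position i (0-based) is  (c , b) :  c = multiplicity of part size i+1,
-- b = whether the distinguished occurrence of part size i+1 is overlined.

Entry : Set
Entry = ℕ × Bool

configs : (bound len : ℕ) → List (Vec Entry len)
configs bound zero = [] ∷ []
configs bound (suc len) =
  concatMap (λ c → concatMap (λ b → map (λ v → (c , b) ∷ v) (configs bound len))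
                                 (false ∷ true ∷ []))
            (upTo (suc bound))

weightFrom : ∀ {len} → ℕ → Vec Entry len → ℕ
weightFrom s [] = 0
weightFrom s ((c , b) ∷ v) = s * c + weightFrom (suc s) v

weight : ∀ {len} → Vec Entry len → ℕ
weight = weightFrom 1

numParts : ∀ {len} → Vec Entry len → ℕ
numParts [] = 0
numParts ((c , b) ∷ v) = c + numParts v

numOver : ∀ {len} → Vec Entry len → ℕ
numOver [] = 0
numOver ((c , true) ∷ v) = suc (numOver v)
numOver ((c , false) ∷ v) = numOver v

isKKOverFrom : ∀ {len} → ℕ → ℕ → Vec Entry len → Bool
isKKOverFrom k s [] = true
isKKOverFrom k s ((c , false) ∷ v) = isKKOverFrom k (suc s) v
isKKOverFrom k s ((c , true) ∷ v) = (1 ≤ᵇ c) ∧ does (k ∣? s) ∧ isKKOverFrom k (suc s) v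

isKKOver : ∀ {len} → ℕ → Vec Entry len → Bool
isKKOver k = isKKOverFrom k 1

isKPart : ∀ {len} → ℕ → Vec Entry len → Bool
isKPart k [] = true
isKPart k ((c , false) ∷ v) = isKPart k v
isKPart k ((c , true) ∷ v) = (k ≤ᵇ c) ∧ isKPart k v

hasStats : ∀ {len} → ℕ → ℕ → ℕ → Vec Entry len → Bool
hasStats ℓ m n v = (weight v ≡ᵇ n) ∧ (numParts v ≡ᵇ m) ∧ (numOver v ≡ᵇ ℓ)

-- Parts of a partition of n are ≤ n and multiplicities are ≤ n, so
-- configs n n enumerates every (marked) partition of n exactly once.

O : ℕ → ℕ → ℕ → ℕ → ℕ
O k ℓ m n = length (filterᵇ (λ v → isKKOver k v ∧ hasStats ℓ m n v) (configs n n))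

P : ℕ → ℕ → ℕ → ℕ → ℕ
P k ℓ m n = length (filterᵇ (λ v → isKPart k v ∧ hasStats ℓ m n v) (configs n n))

-- Splitting every overlined part K t of a (K,K)-overpartition into K copies of t, the K-th of
-- which is overlined, gives a K-partition with the same weight and the same number of overlined
-- parts, and K − 1 more parts per overlined part; merging the K copies back into an overlined K t
-- inverts it. Encoding a partition by its multiplicities and flags on the part sizes 1, …, n, all
-- three statistics are sums over part sizes, and their behaviour under splitting comes down to the
-- reindexing Σ g t = Σ g (K t) for g supported on the overlined part sizes, which are multiples of K.

module Submission where

open import Defs
open import Algebra.Properties.CommutativeSemigroup as CommutativeSemigroupProperties using ()
open import Data.Bool using (Bool; true; false; T; _∧_)
open import Data.Bool.Properties using (T-∧; T?; ∧-identityʳ; ∧-zeroʳ)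
open import Data.List using (List; []; _∷_; length; filter; map; concatMap)
open import Data.List.Properties using (length-map; map-∘; map-id-local)
open import Data.List.Membership.Propositional using (_∈_)
open import Data.List.Membership.Propositional.Properties
  using (∈-map⁺; ∈-map⁻; ∈-filter⁺; ∈-filter⁻; ∈-concat⁺′; ∈-concat⁻′; ∈-upTo⁺)
open import Data.List.Membership.Propositional.Properties.WithK using (unique∧set⇒bag)
open import Data.List.Relation.Binary.BagAndSetEquality using (∼bag⇒↭)
open import Data.List.Relation.Binary.Permutation.Propositional.Properties using (↭-length)
open import Data.List.Relation.Unary.All as All using (All)
import Data.List.Relation.Unary.All.Properties as All
open import Data.List.Relation.Unary.AllPairs as AllPairs using ([]; _∷_)
import Data.List.Relation.Unary.AllPairs.Properties as AllPairs
open import Data.List.Relation.Unary.Any using (here; there)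
open import Data.List.Relation.Unary.Unique.Propositional using (Unique)
import Data.List.Relation.Unary.Unique.Propositional.Properties as Unique
open import Data.Nat using (ℕ; zero; suc; _+_; _*_; _∸_; _≤_; _<_; _≟_; _≤?_; _≤ᵇ_; _/_; z≤n; s≤s; s≤s⁻¹)
open import Data.Nat.Properties
open import Data.Nat.Divisibility using (_∣_; _∣?_; divides; m∣m*n)
open import Data.Nat.DivMod using (m*n/n≡m)
open import Data.Product using (_×_; _,_; proj₁; proj₂)
open import Data.Unit using (tt)
open import Data.Vec using (Vec; []; _∷_)
open import Data.Vec.Properties using (∷-injectiveʳ)
open import Function using (_∘_)
open import Function.Bundles using (_⇔_; mk⇔; Equivalence)
open import Level using (0ℓ)
open import Relation.Binary.PropositionalEquality
open import Relation.Nullary using (¬_; Dec; yes; no; does; contradiction)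
open import Relation.Nullary.Decidable using (dec-true; dec-false)
open import Relation.Unary using (Pred; Decidable)

open CommutativeSemigroupProperties +-commutativeSemigroup using (interchange)
open CommutativeSemigroupProperties *-commutativeSemigroup using (x∙yz≈yx∙z; x∙yz≈y∙xz)

module _ {A B : Set} where

  Unique-map⁺-leftInverse : ∀ (f : A → B) (g : B → A) {xs} →
    All (λ x → g (f x) ≡ x) xs → Unique xs → Unique (map f xs)
  Unique-map⁺-leftInverse f g {xs} gf u =
    Unique.map⁻ {f = g} (subst Unique (sym (trans (sym (map-∘ xs)) (map-id-local gf))) u)

  Unique-concatMap⁺ : ∀ (F : A → List B) (label : B → A) {xs} →
    (∀ x {y} → y ∈ F x → label y ≡ x) → (∀ x → Unique (F x)) →
    Unique xs → Unique (concatMap F xs)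
  Unique-concatMap⁺ F label labelled uniqueF u =
    Unique.concat⁺ (All.map⁺ (All.universal uniqueF _))
      (AllPairs.map⁺ (AllPairs.map disjoint u))
    where
    disjoint : ∀ {x x′} → ¬ x ≡ x′ → ∀ {y} → ¬ (y ∈ F x × y ∈ F x′)
    disjoint x≢x′ (y∈ , y∈′) = x≢x′ (trans (sym (labelled _ y∈)) (labelled _ y∈′))

module _ {A : Set} {P Q : Pred A 0ℓ} (P? : Decidable P) (Q? : Decidable Q) where

  length-filter-bijection : ∀ {xs} (f g : A → A) → Unique xs →
    (∀ {x} → x ∈ xs → P x → f x ∈ xs × Q (f x)) →
    (∀ {y} → y ∈ xs → Q y → g y ∈ xs × P (g y)) →
    (∀ {x} → x ∈ xs → P x → g (f x) ≡ x) →
    (∀ {y} → y ∈ xs → Q y → f (g y) ≡ y) →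
    length (filter P? xs) ≡ length (filter Q? xs)
  length-filter-bijection {xs} f g u f∈ g∈ gf fg = trans (sym (length-map f (filter P? xs)))
    (↭-length (∼bag⇒↭ (unique∧set⇒bag image-unique (Unique.filter⁺ Q? u) (mk⇔ to from))))
    where
    image-unique : Unique (map f (filter P? xs))
    image-unique = Unique-map⁺-leftInverse f g
      (All.tabulate (λ x∈ → let x∈xs , px = ∈-filter⁻ P? x∈ in gf x∈xs px)) (Unique.filter⁺ P? u)
    to : ∀ {y} → y ∈ map f (filter P? xs) → y ∈ filter Q? xs
    to y∈ with ∈-map⁻ f y∈
    ... | x , x∈ , refl =
      let x∈xs , px = ∈-filter⁻ P? x∈ ; fx∈ , qfx = f∈ x∈xs px in ∈-filter⁺ Q? fx∈ qfx
    from : ∀ {y} → y ∈ filter Q? xs → y ∈ map f (filter P? xs)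
    from y∈ = let y∈xs , qy = ∈-filter⁻ Q? y∈ ; gy∈ , pgy = g∈ y∈xs qy in
      subst (_∈ map f (filter P? xs)) (fg y∈xs qy) (∈-map⁺ f (∈-filter⁺ P? gy∈ pgy))

sumRange : ℕ → ℕ → (ℕ → ℕ) → ℕ
sumRange s zero g = 0
sumRange s (suc len) g = g s + sumRange (suc s) len g

inRange-head : ∀ s len → s < s + suc len
inRange-head s len = subst (s <_) (sym (+-suc s len)) (s≤s (m≤m+n s len))

inRange-tail : ∀ s len {t} → suc s ≤ t → t < suc s + len → s ≤ t × t < s + suc len
inRange-tail s len {t} lo hi = <⇒≤ lo , subst (t <_) (sym (+-suc s len)) hi

sumRange-cong : ∀ s len {g h : ℕ → ℕ} → (∀ t → s ≤ t → t < s + len → g t ≡ h t) →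
  sumRange s len g ≡ sumRange s len h
sumRange-cong s zero eq = refl
sumRange-cong s (suc len) eq = cong₂ _+_ (eq s ≤-refl (inRange-head s len))
  (sumRange-cong (suc s) len λ t lo hi → let lo′ , hi′ = inRange-tail s len lo hi in eq t lo′ hi′)

sumRange-zero : ∀ s len {g : ℕ → ℕ} → (∀ t → s ≤ t → t < s + len → g t ≡ 0) → sumRange s len g ≡ 0
sumRange-zero s zero vanish = refl
sumRange-zero s (suc len) vanish = cong₂ _+_ (vanish s ≤-refl (inRange-head s len))
  (sumRange-zero (suc s) len λ t lo hi → let lo′ , hi′ = inRange-tail s len lo hi in vanish t lo′ hi′)

sumRange-distrib-+ : ∀ s len (g h : ℕ → ℕ) →
  sumRange s len (λ t → g t + h t) ≡ sumRange s len g + sumRange s len h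
sumRange-distrib-+ s zero g h = refl
sumRange-distrib-+ s (suc len) g h = trans (cong (g s + h s +_) (sumRange-distrib-+ (suc s) len g h))
  (interchange (g s) (h s) (sumRange (suc s) len g) (sumRange (suc s) len h))

sumRange-*ˡ : ∀ k s len (g : ℕ → ℕ) → sumRange s len (λ t → k * g t) ≡ k * sumRange s len g
sumRange-*ˡ k s zero g = sym (*-zeroʳ k)
sumRange-*ˡ k s (suc len) g =
  trans (cong (k * g s +_) (sumRange-*ˡ k (suc s) len g)) (sym (*-distribˡ-+ k (g s) _))

sumRange-++ : ∀ s a b (g : ℕ → ℕ) → sumRange s (a + b) g ≡ sumRange s a g + sumRange (s + a) b g
sumRange-++ s zero b g = cong (λ s′ → sumRange s′ b g) (sym (+-identityʳ s))
sumRange-++ s (suc a) b g = begin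
  g s + sumRange (suc s) (a + b) g
    ≡⟨ cong (g s +_) (sumRange-++ (suc s) a b g) ⟩
  g s + (sumRange (suc s) a g + sumRange (suc s + a) b g)
    ≡⟨ sym (+-assoc (g s) _ _) ⟩
  sumRange s (suc a) g + sumRange (suc s + a) b g
    ≡⟨ cong (λ s′ → sumRange s (suc a) g + sumRange s′ b g) (sym (+-suc s a)) ⟩
  sumRange s (suc a) g + sumRange (s + suc a) b g ∎
  where open ≡-Reasoning

sumRange-last : ∀ s len (g : ℕ → ℕ) → (∀ t → s ≤ t → t < s + len → g t ≡ 0) →
  sumRange s (suc len) g ≡ g (s + len)
sumRange-last s zero g vanish = trans (+-identityʳ (g s)) (cong g (sym (+-identityʳ s)))
sumRange-last s (suc len) g vanish = begin
  g s + sumRange (suc s) (suc len) g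
    ≡⟨ cong₂ _+_ (vanish s ≤-refl (inRange-head s len)) (sumRange-last (suc s) len g vanish′) ⟩
  g (suc s + len)
    ≡⟨ cong g (sym (+-suc s len)) ⟩
  g (s + suc len) ∎
  where
  open ≡-Reasoning
  vanish′ : ∀ t → suc s ≤ t → t < suc s + len → g t ≡ 0
  vanish′ t lo hi = let lo′ , hi′ = inRange-tail s len lo hi in vanish t lo′ hi′

sumRange-balance : ∀ s len {a b c d : ℕ → ℕ} → (∀ t → s ≤ t → t < s + len → a t + b t ≡ c t + d t) →
  sumRange s len a + sumRange s len b ≡ sumRange s len c + sumRange s len d
sumRange-balance s len {a} {b} {c} {d} eq = begin
  sumRange s len a + sumRange s len b
    ≡⟨ sym (sumRange-distrib-+ s len a b) ⟩
  sumRange s len (λ t → a t + b t)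
    ≡⟨ sumRange-cong s len eq ⟩
  sumRange s len (λ t → c t + d t)
    ≡⟨ sumRange-distrib-+ s len c d ⟩
  sumRange s len c + sumRange s len d ∎
  where open ≡-Reasoning

module _ (k : ℕ) where

  private
    K = suc k

  ∤-between-multiples : ∀ a {t} → K * a < t → t < K * suc a → ¬ K ∣ t
  ∤-between-multiples a lo hi (divides q refl) =
    <⇒≱ (*-cancelˡ-< K a q (subst (K * a <_) (*-comm q K) lo))
        (s≤s⁻¹ (*-cancelˡ-< K q (suc a) (subst (_< K * suc a) (*-comm q K) hi)))

  block-end : ∀ a → suc (K * a) + k ≡ K * suc a
  block-end a = trans (cong suc (+-comm (K * a) k)) (sym (*-suc K a))

  module _ (g : ℕ → ℕ) (vanish : ∀ t → ¬ K ∣ t → g t ≡ 0) where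

    sumRange-blocks : ∀ a N → sumRange (suc (K * a)) (K * N) g ≡ sumRange (suc a) N (λ t → g (K * t))
    sumRange-blocks a zero = cong (λ len → sumRange (suc (K * a)) len g) (*-zeroʳ K)
    sumRange-blocks a (suc N) = begin
      sumRange (suc (K * a)) (K * suc N) g
        ≡⟨ cong (λ len → sumRange (suc (K * a)) len g) (*-suc K N) ⟩
      sumRange (suc (K * a)) (K + K * N) g
        ≡⟨ sumRange-++ (suc (K * a)) K (K * N) g ⟩
      sumRange (suc (K * a)) K g + sumRange (suc (K * a) + K) (K * N) g
        ≡⟨ cong₂ _+_ block (cong (λ s → sumRange s (K * N) g) next) ⟩
      g (K * suc a) + sumRange (suc (K * suc a)) (K * N) g
        ≡⟨ cong (g (K * suc a) +_) (sumRange-blocks (suc a) N) ⟩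
      sumRange (suc a) (suc N) (λ t → g (K * t)) ∎
      where
      open ≡-Reasoning
      next : suc (K * a) + K ≡ suc (K * suc a)
      next = cong suc (trans (+-comm (K * a) K) (sym (*-suc K a)))
      block : sumRange (suc (K * a)) K g ≡ g (K * suc a)
      block = trans (sumRange-last (suc (K * a)) k g λ t lo hi →
                       vanish t (∤-between-multiples a lo (subst (t <_) (block-end a) hi)))
                    (cong g (block-end a))

    sumRange-multiples : ∀ n → (∀ t → n < t → g t ≡ 0) → sumRange 1 n g ≡ sumRange 1 n (λ t → g (K * t))
    sumRange-multiples n beyond = begin
      sumRange 1 n g
        ≡⟨ sym (+-identityʳ _) ⟩
      sumRange 1 n g + 0
        ≡⟨ cong (sumRange 1 n g +_) (sym (sumRange-zero (1 + n) (k * n) λ t lo _ → beyond t lo)) ⟩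
      sumRange 1 n g + sumRange (1 + n) (k * n) g
        ≡⟨ sym (sumRange-++ 1 n (k * n) g) ⟩
      sumRange 1 (K * n) g
        ≡⟨ cong (λ s → sumRange (suc s) (K * n) g) (sym (*-zeroʳ K)) ⟩
      sumRange (suc (K * 0)) (K * n) g
        ≡⟨ sumRange-blocks 0 n ⟩
      sumRange 1 n (λ t → g (K * t)) ∎
      where open ≡-Reasoning

bit : Bool → ℕ
bit true = 1
bit false = 0

bit-true : ∀ {b} → T b → bit b ≡ 1
bit-true {true} _ = refl

bit-false : ∀ {b} → ¬ T b → bit b ≡ 0
bit-false {false} _ = refl
bit-false {true} ¬b = contradiction tt ¬b

¬T⇒≡false : ∀ {b} → ¬ T b → b ≡ false
¬T⇒≡false {false} _ = refl
¬T⇒≡false {true} ¬b = contradiction tt ¬b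

T-does⇒ : ∀ {P : Set} (p? : Dec P) → T (does p?) → P
T-does⇒ (yes p) _ = p

bit-≤ : ∀ {b c} → (T b → 1 ≤ c) → bit b ≤ c
bit-≤ {false} _ = z≤n
bit-≤ {true} h = h tt

*-bit-≤ : ∀ m {b c} → (T b → m ≤ c) → m * bit b ≤ c
*-bit-≤ m {false} _ = ≤-trans (≤-reflexive (*-zeroʳ m)) z≤n
*-bit-≤ m {true} h = ≤-trans (≤-reflexive (*-identityʳ m)) (h tt)

m+n∸o+o≡m+n : ∀ {m} n {o} → o ≤ m → m + n ∸ o + o ≡ m + n
m+n∸o+o≡m+n {m} n o≤m = m∸n+n≡m (≤-trans o≤m (m≤m+n m n))

n≤m+n∸o : ∀ {m} n {o} → o ≤ m → n ≤ m + n ∸ o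
n≤m+n∸o {m} n {o} o≤m = subst (n ≤_) (sym (+-∸-comm n o≤m)) (m≤n+m n (m ∸ o))

entryChoices : (bound len : ℕ) → ℕ → List (Vec Entry (suc len))
entryChoices bound len c =
  concatMap (λ b → map ((c , b) ∷_) (configs bound len)) (false ∷ true ∷ [])

configs-unique : ∀ bound len → Unique (configs bound len)
configs-unique bound zero = All.[] ∷ []
configs-unique bound (suc len) =
  Unique-concatMap⁺ (entryChoices bound len) headMult labelMult uniqueChoices (Unique.upTo⁺ (suc bound))
  where
  withFlag : ℕ → Bool → List (Vec Entry (suc len))
  withFlag c b = map ((c , b) ∷_) (configs bound len)
  headMult : Vec Entry (suc len) → ℕ
  headMult ((c , _) ∷ _) = c
  headFlag : Vec Entry (suc len) → Bool
  headFlag ((_ , b) ∷ _) = b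
  labelMult : ∀ c {v} → v ∈ entryChoices bound len c → headMult v ≡ c
  labelMult c v∈ with ∈-concat⁻′ (map (withFlag c) (false ∷ true ∷ [])) v∈
  ... | _ , v∈vs , vs∈ with ∈-map⁻ (withFlag c) vs∈
  ... | b , _ , refl with ∈-map⁻ ((c , b) ∷_) v∈vs
  ... | _ , _ , refl = refl
  uniqueChoices : ∀ c → Unique (entryChoices bound len c)
  uniqueChoices c = Unique-concatMap⁺ _ headFlag labelFlag
    (λ b → Unique.map⁺ ∷-injectiveʳ (configs-unique bound len)) (((λ ()) All.∷ All.[]) ∷ All.[] ∷ [])
    where
    labelFlag : ∀ b {v} → v ∈ withFlag c b → headFlag v ≡ b
    labelFlag b v∈ with ∈-map⁻ _ v∈
    ... | _ , _ , refl = refl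

∈-configs : ∀ {len} bound s (v : Vec Entry len) → weightFrom (suc s) v ≤ bound → v ∈ configs bound len
∈-configs bound s [] _ = here refl
∈-configs {suc len} bound s ((c , b) ∷ v) bounded =
  ∈-concat⁺′ (∈-concat⁺′ (∈-map⁺ ((c , b) ∷_) (∈-configs bound (suc s) v tailBounded))
                          (∈-map⁺ (λ b′ → map ((c , b′) ∷_) (configs bound len)) (flagChoice b)))
             (∈-map⁺ (entryChoices bound len) (∈-upTo⁺ (s≤s c≤bound)))
  where
  flagChoice : ∀ b → b ∈ false ∷ true ∷ []
  flagChoice false = here refl
  flagChoice true = there (here refl)
  tailBounded : weightFrom (suc (suc s)) v ≤ bound
  tailBounded = ≤-trans (m≤n+m _ (suc s * c)) bounded
  c≤bound : c ≤ bound
  c≤bound = ≤-trans (m≤n*m c (suc s)) (≤-trans (m≤m+n (suc s * c) _) bounded)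

blank : Entry
blank = (0 , false)

entryFrom : ∀ {len} → ℕ → Vec Entry len → ℕ → Entry
entryFrom s [] t = blank
entryFrom s (e ∷ v) t with t ≟ s
... | yes _ = e
... | no _ = entryFrom (suc s) v t

tabulateFrom : (s len : ℕ) → (ℕ → Entry) → Vec Entry len
tabulateFrom s zero F = []
tabulateFrom s (suc len) F = F s ∷ tabulateFrom (suc s) len F

entryFrom-tabulateFrom : ∀ s len F {t} → s ≤ t → t < s + len → entryFrom s (tabulateFrom s len F) t ≡ F t
entryFrom-tabulateFrom s zero F {t} lo hi = contradiction (subst (t <_) (+-identityʳ s) hi) (≤⇒≯ lo)
entryFrom-tabulateFrom s (suc len) F {t} lo hi with t ≟ s
... | yes refl = refl
... | no t≢s =
  entryFrom-tabulateFrom (suc s) len F (≤∧≢⇒< lo (t≢s ∘ sym)) (subst (t <_) (+-suc s len) hi)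

entryFrom-beyond : ∀ {len} s (v : Vec Entry len) {t} → s + len ≤ t → entryFrom s v t ≡ blank
entryFrom-beyond s [] le = refl
entryFrom-beyond {suc len} s (e ∷ v) {t} le with t ≟ s
... | yes refl = contradiction le (<⇒≱ (inRange-head s len))
... | no _ = entryFrom-beyond (suc s) v (subst (_≤ t) (+-suc s len) le)

tabulateFrom-cong : ∀ s len {F G : ℕ → Entry} → (∀ t → s ≤ t → t < s + len → F t ≡ G t) →
  tabulateFrom s len F ≡ tabulateFrom s len G
tabulateFrom-cong s zero eq = refl
tabulateFrom-cong s (suc len) eq = cong₂ _∷_ (eq s ≤-refl (inRange-head s len))
  (tabulateFrom-cong (suc s) len λ t lo hi → let lo′ , hi′ = inRange-tail s len lo hi in eq t lo′ hi′)

tabulateFrom-entryFrom : ∀ {len} s (v : Vec Entry len) → tabulateFrom s len (entryFrom s v) ≡ v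
tabulateFrom-entryFrom s [] = refl
tabulateFrom-entryFrom {suc len} s (e ∷ v) with s ≟ s
... | no s≢s = contradiction refl s≢s
... | yes _ =
  cong (e ∷_) (trans (tabulateFrom-cong (suc s) len skipHead) (tabulateFrom-entryFrom (suc s) v))
  where
  skipHead : ∀ t → suc s ≤ t → t < suc s + len → entryFrom s (e ∷ v) t ≡ entryFrom (suc s) v t
  skipHead t lo _ with t ≟ s
  ... | yes refl = contradiction lo (<-irrefl refl)
  ... | no _ = refl

weightFrom-tabulateFrom : ∀ s len F →
  weightFrom s (tabulateFrom s len F) ≡ sumRange s len (λ t → t * proj₁ (F t))
weightFrom-tabulateFrom s zero F = refl
weightFrom-tabulateFrom s (suc len) F = cong (s * proj₁ (F s) +_) (weightFrom-tabulateFrom (suc s) len F)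

numParts-tabulateFrom : ∀ s len F →
  numParts (tabulateFrom s len F) ≡ sumRange s len (λ t → proj₁ (F t))
numParts-tabulateFrom s zero F = refl
numParts-tabulateFrom s (suc len) F = cong (proj₁ (F s) +_) (numParts-tabulateFrom (suc s) len F)

numOver-tabulateFrom : ∀ s len F →
  numOver (tabulateFrom s len F) ≡ sumRange s len (λ t → bit (proj₂ (F t)))
numOver-tabulateFrom s zero F = refl
numOver-tabulateFrom s (suc len) F with F s
... | (c , true) = cong suc (numOver-tabulateFrom (suc s) len F)
... | (c , false) = numOver-tabulateFrom (suc s) len F

*-mult-≤-weightFrom : ∀ {len} s (v : Vec Entry len) t → t * proj₁ (entryFrom s v t) ≤ weightFrom s v
*-mult-≤-weightFrom s [] t = ≤-reflexive (*-zeroʳ t)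
*-mult-≤-weightFrom s ((c , b) ∷ v) t with t ≟ s
... | yes refl = m≤m+n (t * c) _
... | no _ = ≤-trans (*-mult-≤-weightFrom (suc s) v t) (m≤n+m _ (s * c))

KKAdmissible : ℕ → ℕ → Entry → Set
KKAdmissible k t e = T (proj₂ e) → 1 ≤ proj₁ e × k ∣ t

KAdmissible : ℕ → Entry → Set
KAdmissible k e = T (proj₂ e) → k ≤ proj₁ e

module _ (k : ℕ) where

  isKKOverFrom-∷⁻ : ∀ {len} s e (v : Vec Entry len) → T (isKKOverFrom k s (e ∷ v)) →
    KKAdmissible k s e × T (isKKOverFrom k (suc s) v)
  isKKOverFrom-∷⁻ s (c , false) v valid = (λ ()) , valid
  isKKOverFrom-∷⁻ s (c , true) v valid with k ∣? s
  ... | yes k∣s = let 1≤ᵇc , rest = Equivalence.to T-∧ valid in (λ _ → ≤ᵇ⇒≤ 1 c 1≤ᵇc , k∣s) , rest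
  ... | no _ with () ← proj₂ (Equivalence.to (T-∧ {1 ≤ᵇ c}) valid)

  isKKOverFrom-∷⁺ : ∀ {len} s e (v : Vec Entry len) → KKAdmissible k s e →
    T (isKKOverFrom k (suc s) v) → T (isKKOverFrom k s (e ∷ v))
  isKKOverFrom-∷⁺ s (c , false) v _ valid = valid
  isKKOverFrom-∷⁺ s (c , true) v admissible valid with admissible tt | k ∣? s
  ... | 1≤c , _ | yes _ = Equivalence.from T-∧ (≤⇒≤ᵇ 1≤c , valid)
  ... | _ , k∣s | no k∤s = contradiction k∣s k∤s

  isKKOverFrom-admissible : ∀ {len} s (v : Vec Entry len) → T (isKKOverFrom k s v) →
    ∀ t → KKAdmissible k t (entryFrom s v t)
  isKKOverFrom-admissible s [] _ t ()
  isKKOverFrom-admissible s (e ∷ v) valid t with t ≟ s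
  ... | yes refl = proj₁ (isKKOverFrom-∷⁻ s e v valid)
  ... | no _ = isKKOverFrom-admissible (suc s) v (proj₂ (isKKOverFrom-∷⁻ s e v valid)) t

  tabulateFrom-isKKOverFrom : ∀ s len F → (∀ t → s ≤ t → KKAdmissible k t (F t)) →
    T (isKKOverFrom k s (tabulateFrom s len F))
  tabulateFrom-isKKOverFrom s zero F admissible = tt
  tabulateFrom-isKKOverFrom s (suc len) F admissible = isKKOverFrom-∷⁺ s (F s) _ (admissible s ≤-refl)
    (tabulateFrom-isKKOverFrom (suc s) len F λ t lo → admissible t (<⇒≤ lo))

  isKPart-∷⁻ : ∀ {len} e (v : Vec Entry len) → T (isKPart k (e ∷ v)) →
    KAdmissible k e × T (isKPart k v)
  isKPart-∷⁻ (c , false) v valid = (λ ()) , valid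
  isKPart-∷⁻ (c , true) v valid with Equivalence.to T-∧ valid
  ... | k≤ᵇc , rest = (λ _ → ≤ᵇ⇒≤ k c k≤ᵇc) , rest

  isKPart-∷⁺ : ∀ {len} e (v : Vec Entry len) → KAdmissible k e →
    T (isKPart k v) → T (isKPart k (e ∷ v))
  isKPart-∷⁺ (c , false) v _ valid = valid
  isKPart-∷⁺ (c , true) v admissible valid = Equivalence.from T-∧ (≤⇒≤ᵇ (admissible tt) , valid)

  isKPart-admissible : ∀ {len} s (v : Vec Entry len) → T (isKPart k v) →
    ∀ t → KAdmissible k (entryFrom s v t)
  isKPart-admissible s [] _ t ()
  isKPart-admissible s (e ∷ v) valid t with t ≟ s
  ... | yes refl = proj₁ (isKPart-∷⁻ e v valid)
  ... | no _ = isKPart-admissible (suc s) v (proj₂ (isKPart-∷⁻ e v valid)) t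

  tabulateFrom-isKPart : ∀ s len F → (∀ t → s ≤ t → KAdmissible k (F t)) →
    T (isKPart k (tabulateFrom s len F))
  tabulateFrom-isKPart s zero F admissible = tt
  tabulateFrom-isKPart s (suc len) F admissible = isKPart-∷⁺ (F s) _ (admissible s ≤-refl)
    (tabulateFrom-isKPart (suc s) len F λ t lo → admissible t (<⇒≤ lo))

T-hasStats : ∀ {len} ℓ m n (v : Vec Entry len) →
  T (hasStats ℓ m n v) ⇔ (weight v ≡ n × numParts v ≡ m × numOver v ≡ ℓ)
T-hasStats ℓ m n v = mk⇔ to from
  where
  to : T (hasStats ℓ m n v) → weight v ≡ n × numParts v ≡ m × numOver v ≡ ℓ
  to stats = let w , rest = Equivalence.to T-∧ stats ; p , o = Equivalence.to T-∧ rest in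
    ≡ᵇ⇒≡ _ _ w , ≡ᵇ⇒≡ _ _ p , ≡ᵇ⇒≡ _ _ o
  from : weight v ≡ n × numParts v ≡ m × numOver v ≡ ℓ → T (hasStats ℓ m n v)
  from (w , p , o) = Equivalence.from T-∧ (≡⇒≡ᵇ _ _ w , Equivalence.from T-∧ (≡⇒≡ᵇ _ _ p , ≡⇒≡ᵇ _ _ o))

-- K is the k of the statement; each split adds k = K − 1 parts.
module Bijection (k n : ℕ) where

  K : ℕ
  K = suc k

  Config : Set
  Config = Vec Entry n

  entry : Config → ℕ → Entry
  entry = entryFrom 1

  mult : Config → ℕ → ℕ
  mult v t = proj₁ (entry v t)

  flag : Config → ℕ → Bool
  flag v t = proj₂ (entry v t)

  entry-tabulate : ∀ F {t} → 1 ≤ t → t < 1 + n → entry (tabulateFrom 1 n F) t ≡ F t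
  entry-tabulate F = entryFrom-tabulateFrom 1 n F

  flag-beyond : ∀ v {t} → n < t → ¬ T (flag v t)
  flag-beyond v n<t = subst T (cong proj₂ (entryFrom-beyond 1 v n<t))

  weight-sum : ∀ v → weight v ≡ sumRange 1 n (λ t → t * mult v t)
  weight-sum v =
    trans (cong weight (sym (tabulateFrom-entryFrom 1 v))) (weightFrom-tabulateFrom 1 n (entry v))

  numParts-sum : ∀ v → numParts v ≡ sumRange 1 n (mult v)
  numParts-sum v =
    trans (cong numParts (sym (tabulateFrom-entryFrom 1 v))) (numParts-tabulateFrom 1 n (entry v))

  numOver-sum : ∀ v → numOver v ≡ sumRange 1 n (λ t → bit (flag v t))
  numOver-sum v =
    trans (cong numOver (sym (tabulateFrom-entryFrom 1 v))) (numOver-tabulateFrom 1 n (entry v))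

  splitEntry : Config → ℕ → Entry
  splitEntry v t = (mult v t + K * bit (flag v (K * t)) ∸ bit (flag v t) , flag v (K * t))

  split : Config → Config
  split v = tabulateFrom 1 n (splitEntry v)

  -- t / K is junk unless K ∣ t; the second conjunct discards it.
  mergedFlag : Config → ℕ → Bool
  mergedFlag w t = flag w (t / K) ∧ does (K ∣? t)

  mergeEntry : Config → ℕ → Entry
  mergeEntry w t = (mult w t + bit (mergedFlag w t) ∸ K * bit (flag w t) , mergedFlag w t)

  merge : Config → Config
  merge w = tabulateFrom 1 n (mergeEntry w)

  splitMult-+ : ∀ v t → bit (flag v t) ≤ mult v t →
    proj₁ (splitEntry v t) + bit (flag v t) ≡ mult v t + K * bit (flag v (K * t))
  splitMult-+ v t = m+n∸o+o≡m+n (K * bit (flag v (K * t)))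

  mergeMult-+ : ∀ w t → K * bit (flag w t) ≤ mult w t →
    proj₁ (mergeEntry w t) + K * bit (flag w t) ≡ mult w t + bit (mergedFlag w t)
  mergeMult-+ w t = m+n∸o+o≡m+n (bit (mergedFlag w t))

  module _ (v : Config) (valid : T (isKKOver K v)) where

    flag⇒∣ : ∀ {t} → T (flag v t) → K ∣ t
    flag⇒∣ {t} = proj₂ ∘ isKKOverFrom-admissible K 1 v valid t

    bit-flag≤mult : ∀ t → bit (flag v t) ≤ mult v t
    bit-flag≤mult t = bit-≤ (proj₁ ∘ isKKOverFrom-admissible K 1 v valid t)

    sumRange-overlined : ∀ (g : ℕ → ℕ) → (∀ t → ¬ T (flag v t) → g t ≡ 0) →
      sumRange 1 n g ≡ sumRange 1 n (λ t → g (K * t))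
    sumRange-overlined g support =
      sumRange-multiples k g (λ t K∤t → support t (K∤t ∘ flag⇒∣)) n
        (λ t n<t → support t (flag-beyond v n<t))

    numOver-multiples : sumRange 1 n (λ t → bit (flag v (K * t))) ≡ numOver v
    numOver-multiples = trans (sym (sumRange-overlined _ (λ _ → bit-false))) (sym (numOver-sum v))

    weightOver-multiples :
      sumRange 1 n (λ t → t * bit (flag v t)) ≡ sumRange 1 n (λ t → K * t * bit (flag v (K * t)))
    weightOver-multiples = sumRange-overlined _ λ t ¬overlined →
      trans (cong (t *_) (bit-false ¬overlined)) (*-zeroʳ t)

  module _ (w : Config) (valid : T (isKPart K w)) where

    K*bit-flag≤mult : ∀ t → K * bit (flag w t) ≤ mult w t
    K*bit-flag≤mult t = *-bit-≤ K (isKPart-admissible K 1 w valid t)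

    K*overlined≤ : weight w ≤ n → ∀ {t} → T (flag w t) → K * t ≤ n
    K*overlined≤ bounded {t} overlined = begin
      K * t
        ≡⟨ *-comm K t ⟩
      t * K
        ≤⟨ *-monoʳ-≤ t (isKPart-admissible K 1 w valid t overlined) ⟩
      t * mult w t
        ≤⟨ *-mult-≤-weightFrom 1 w t ⟩
      weight w
        ≤⟨ bounded ⟩
      n ∎
      where open ≤-Reasoning

  module SplitProperties (v : Config) (valid : T (isKKOver K v)) where

    isKPart-split : T (isKPart K (split v))
    isKPart-split = tabulateFrom-isKPart K 1 n (splitEntry v) λ t _ overlined →
      subst (_≤ proj₁ (splitEntry v t)) (trans (cong (K *_) (bit-true overlined)) (*-identityʳ K))
        (n≤m+n∸o (K * bit (flag v (K * t))) (bit-flag≤mult v valid t))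

    weight-split : weight (split v) ≡ weight v
    weight-split = +-cancelʳ-≡ G _ _ (begin
      weight (split v) + G
        ≡⟨ cong (_+ G) (weightFrom-tabulateFrom 1 n (splitEntry v)) ⟩
      sumRange 1 n (λ t → t * proj₁ (splitEntry v t)) + G
        ≡⟨ sumRange-balance 1 n (λ t _ _ → pointwise t) ⟩
      sumRange 1 n (λ t → t * mult v t) + sumRange 1 n (λ t → K * t * bit (flag v (K * t)))
        ≡⟨ cong₂ _+_ (sym (weight-sum v)) (sym (weightOver-multiples v valid)) ⟩
      weight v + G ∎)
      where
      open ≡-Reasoning
      G = sumRange 1 n (λ t → t * bit (flag v t))
      pointwise : ∀ t →
        t * proj₁ (splitEntry v t) + t * bit (flag v t) ≡ t * mult v t + K * t * bit (flag v (K * t))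
      pointwise t = begin
        t * proj₁ (splitEntry v t) + t * bit (flag v t)
          ≡⟨ sym (*-distribˡ-+ t _ _) ⟩
        t * (proj₁ (splitEntry v t) + bit (flag v t))
          ≡⟨ cong (t *_) (splitMult-+ v t (bit-flag≤mult v valid t)) ⟩
        t * (mult v t + K * bit (flag v (K * t)))
          ≡⟨ *-distribˡ-+ t _ _ ⟩
        t * mult v t + t * (K * bit (flag v (K * t)))
          ≡⟨ cong (t * mult v t +_) (x∙yz≈yx∙z t K _) ⟩
        t * mult v t + K * t * bit (flag v (K * t)) ∎

    numOver-split : numOver (split v) ≡ numOver v
    numOver-split = trans (numOver-tabulateFrom 1 n (splitEntry v)) (numOver-multiples v valid)

    numParts-split : numParts (split v) ≡ numParts v + k * numOver v
    numParts-split = +-cancelʳ-≡ H _ _ (begin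
      numParts (split v) + H
        ≡⟨ cong₂ _+_ (numParts-tabulateFrom 1 n (splitEntry v)) (numOver-sum v) ⟩
      sumRange 1 n (λ t → proj₁ (splitEntry v t)) + sumRange 1 n (λ t → bit (flag v t))
        ≡⟨ sumRange-balance 1 n (λ t _ _ → splitMult-+ v t (bit-flag≤mult v valid t)) ⟩
      sumRange 1 n (mult v) + sumRange 1 n (λ t → K * bit (flag v (K * t)))
        ≡⟨ cong₂ _+_ (sym (numParts-sum v)) (sumRange-*ˡ K 1 n _) ⟩
      numParts v + K * sumRange 1 n (λ t → bit (flag v (K * t)))
        ≡⟨ cong (λ x → numParts v + K * x) (numOver-multiples v valid) ⟩
      numParts v + (H + k * H)
        ≡⟨ cong (numParts v +_) (+-comm H (k * H)) ⟩
      numParts v + (k * H + H)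
        ≡⟨ sym (+-assoc (numParts v) (k * H) H) ⟩
      numParts v + k * H + H ∎)
      where
      open ≡-Reasoning
      H = numOver v

    flag-split : ∀ {t} → 1 ≤ t → t < 1 + n → flag (split v) t ≡ flag v (K * t)
    flag-split lo hi = cong proj₂ (entry-tabulate (splitEntry v) lo hi)

    mergedFlag-split : ∀ {t} → 1 ≤ t → t < 1 + n → mergedFlag (split v) t ≡ flag v t
    mergedFlag-split {t} lo hi with K ∣? t
    ... | no K∤t = begin
      flag (split v) (t / K) ∧ does (K ∣? t)
        ≡⟨ cong (flag (split v) (t / K) ∧_) (dec-false (K ∣? t) K∤t) ⟩
      flag (split v) (t / K) ∧ false
        ≡⟨ ∧-zeroʳ _ ⟩
      false
        ≡⟨ sym (¬T⇒≡false (K∤t ∘ flag⇒∣ v valid)) ⟩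
      flag v t ∎
      where open ≡-Reasoning
    ... | yes (divides zero refl) = contradiction lo λ ()
    ... | yes K∣t@(divides q@(suc _) refl) = begin
      flag (split v) (q * K / K) ∧ does (K ∣? (q * K))
        ≡⟨ cong (flag (split v) (q * K / K) ∧_) (dec-true (K ∣? (q * K)) K∣t) ⟩
      flag (split v) (q * K / K) ∧ true
        ≡⟨ ∧-identityʳ _ ⟩
      flag (split v) (q * K / K)
        ≡⟨ cong (flag (split v)) (m*n/n≡m q K) ⟩
      flag (split v) q
        ≡⟨ flag-split (s≤s z≤n) (≤-<-trans (m≤m*n q K) hi) ⟩
      flag v (K * q)
        ≡⟨ cong (flag v) (*-comm K q) ⟩
      flag v (q * K) ∎
      where open ≡-Reasoning

    merge-split : merge (split v) ≡ v
    merge-split = trans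
      (tabulateFrom-cong 1 n λ t lo hi → cong₂ _,_ (mult-merge-split lo hi) (mergedFlag-split lo hi))
      (tabulateFrom-entryFrom 1 v)
      where
      mult-merge-split : ∀ {t} → 1 ≤ t → t < 1 + n → proj₁ (mergeEntry (split v) t) ≡ mult v t
      mult-merge-split {t} lo hi = +-cancelʳ-≡ (K * bit (flag v (K * t))) _ _ (begin
        proj₁ (mergeEntry (split v) t) + K * bit (flag v (K * t))
          ≡⟨ cong (λ b → proj₁ (mergeEntry (split v) t) + K * bit b) (sym (flag-split lo hi)) ⟩
        proj₁ (mergeEntry (split v) t) + K * bit (flag (split v) t)
          ≡⟨ mergeMult-+ (split v) t (K*bit-flag≤mult (split v) isKPart-split t) ⟩
        mult (split v) t + bit (mergedFlag (split v) t)
          ≡⟨ cong (λ b → mult (split v) t + bit b) (mergedFlag-split lo hi) ⟩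
        mult (split v) t + bit (flag v t)
          ≡⟨ cong (λ e → proj₁ e + bit (flag v t)) (entry-tabulate (splitEntry v) lo hi) ⟩
        proj₁ (splitEntry v t) + bit (flag v t)
          ≡⟨ splitMult-+ v t (bit-flag≤mult v valid t) ⟩
        mult v t + K * bit (flag v (K * t)) ∎)
        where open ≡-Reasoning

  module MergeProperties (w : Config) (valid : T (isKPart K w)) (bounded : weight w ≤ n) where

    flag-merge : ∀ {t} → 1 ≤ t → t < 1 + n → flag (merge w) t ≡ mergedFlag w t
    flag-merge lo hi = cong proj₂ (entry-tabulate (mergeEntry w) lo hi)

    flag-merge-multiple : ∀ {t} → 1 ≤ t → flag (merge w) (K * t) ≡ flag w t
    flag-merge-multiple {t} lo with K * t ≤? n
    ... | no K*t≰n = trans (¬T⇒≡false (flag-beyond (merge w) (≰⇒> K*t≰n)))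
                           (sym (¬T⇒≡false (K*t≰n ∘ K*overlined≤ w valid bounded)))
    ... | yes K*t≤n = begin
      flag (merge w) (K * t)
        ≡⟨ flag-merge (≤-trans lo (m≤n*m t K)) (s≤s K*t≤n) ⟩
      flag w (K * t / K) ∧ does (K ∣? (K * t))
        ≡⟨ cong₂ _∧_ (cong (flag w) K*t/K≡t) (dec-true (K ∣? (K * t)) (m∣m*n t)) ⟩
      flag w t ∧ true
        ≡⟨ ∧-identityʳ _ ⟩
      flag w t ∎
      where
      open ≡-Reasoning
      K*t/K≡t : K * t / K ≡ t
      K*t/K≡t = trans (cong (_/ K) (*-comm K t)) (m*n/n≡m t K)

    isKKOver-merge : T (isKKOver K (merge w))
    isKKOver-merge = tabulateFrom-isKKOverFrom K 1 n (mergeEntry w) λ t _ overlined →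
      subst (_≤ proj₁ (mergeEntry w t)) (bit-true overlined)
        (n≤m+n∸o (bit (mergedFlag w t)) (K*bit-flag≤mult w valid t)) ,
      T-does⇒ (K ∣? t) (proj₂ (Equivalence.to (T-∧ {flag w (t / K)}) overlined))

    numOver-merge : numOver (merge w) ≡ numOver w
    numOver-merge = begin
      numOver (merge w)
        ≡⟨ numOver-multiples (merge w) isKKOver-merge ⟨
      sumRange 1 n (λ t → bit (flag (merge w) (K * t)))
        ≡⟨ sumRange-cong 1 n (λ t lo _ → cong bit (flag-merge-multiple lo)) ⟩
      sumRange 1 n (λ t → bit (flag w t))
        ≡⟨ numOver-sum w ⟨
      numOver w ∎
      where open ≡-Reasoning

    weight-merge : weight (merge w) ≡ weight w
    weight-merge = +-cancelʳ-≡ (K * A) _ _ (begin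
      weight (merge w) + K * A
        ≡⟨ cong₂ _+_ (weightFrom-tabulateFrom 1 n (mergeEntry w)) (sym (sumRange-*ˡ K 1 n _)) ⟩
      sumRange 1 n (λ t → t * proj₁ (mergeEntry w t)) + sumRange 1 n (λ t → K * (t * bit (flag w t)))
        ≡⟨ sumRange-balance 1 n (λ t _ _ → pointwise t) ⟩
      sumRange 1 n (λ t → t * mult w t) + sumRange 1 n (λ t → t * bit (mergedFlag w t))
        ≡⟨ cong₂ _+_ (sym (weight-sum w)) mergedWeight ⟩
      weight w + K * A ∎)
      where
      open ≡-Reasoning
      A = sumRange 1 n (λ t → t * bit (flag w t))
      pointwise : ∀ t →
        t * proj₁ (mergeEntry w t) + K * (t * bit (flag w t)) ≡ t * mult w t + t * bit (mergedFlag w t)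
      pointwise t = begin
        t * proj₁ (mergeEntry w t) + K * (t * bit (flag w t))
          ≡⟨ cong (t * proj₁ (mergeEntry w t) +_) (x∙yz≈y∙xz K t _) ⟩
        t * proj₁ (mergeEntry w t) + t * (K * bit (flag w t))
          ≡⟨ sym (*-distribˡ-+ t _ _) ⟩
        t * (proj₁ (mergeEntry w t) + K * bit (flag w t))
          ≡⟨ cong (t *_) (mergeMult-+ w t (K*bit-flag≤mult w valid t)) ⟩
        t * (mult w t + bit (mergedFlag w t))
          ≡⟨ *-distribˡ-+ t _ _ ⟩
        t * mult w t + t * bit (mergedFlag w t) ∎
      mergedWeight : sumRange 1 n (λ t → t * bit (mergedFlag w t)) ≡ K * A
      mergedWeight = begin
        sumRange 1 n (λ t → t * bit (mergedFlag w t))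
          ≡⟨ sumRange-cong 1 n (λ t lo hi → cong (λ b → t * bit b) (sym (flag-merge lo hi))) ⟩
        sumRange 1 n (λ t → t * bit (flag (merge w) t))
          ≡⟨ weightOver-multiples (merge w) isKKOver-merge ⟩
        sumRange 1 n (λ t → K * t * bit (flag (merge w) (K * t)))
          ≡⟨ sumRange-cong 1 n (λ t lo _ →
               trans (cong (λ b → K * t * bit b) (flag-merge-multiple lo)) (*-assoc K t _)) ⟩
        sumRange 1 n (λ t → K * (t * bit (flag w t)))
          ≡⟨ sumRange-*ˡ K 1 n _ ⟩
        K * A ∎

    numParts-merge : numParts (merge w) + k * numOver w ≡ numParts w
    numParts-merge = +-cancelʳ-≡ B _ _ (begin
      numParts (merge w) + k * B + B
        ≡⟨ +-assoc (numParts (merge w)) (k * B) B ⟩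
      numParts (merge w) + (k * B + B)
        ≡⟨ cong (numParts (merge w) +_) (+-comm (k * B) B) ⟩
      numParts (merge w) + K * B
        ≡⟨ cong₂ _+_ (numParts-tabulateFrom 1 n (mergeEntry w))
                     (trans (cong (K *_) (numOver-sum w)) (sym (sumRange-*ˡ K 1 n _))) ⟩
      sumRange 1 n (λ t → proj₁ (mergeEntry w t)) + sumRange 1 n (λ t → K * bit (flag w t))
        ≡⟨ sumRange-balance 1 n (λ t _ _ → mergeMult-+ w t (K*bit-flag≤mult w valid t)) ⟩
      sumRange 1 n (mult w) + sumRange 1 n (λ t → bit (mergedFlag w t))
        ≡⟨ cong₂ _+_ (sym (numParts-sum w))
                     (trans (sym (numOver-tabulateFrom 1 n (mergeEntry w))) numOver-merge) ⟩
      numParts w + B ∎)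
      where
      open ≡-Reasoning
      B = numOver w

    split-merge : split (merge w) ≡ w
    split-merge = trans
      (tabulateFrom-cong 1 n λ t lo hi → cong₂ _,_ (mult-split-merge lo hi) (flag-merge-multiple lo))
      (tabulateFrom-entryFrom 1 w)
      where
      mult-split-merge : ∀ {t} → 1 ≤ t → t < 1 + n → proj₁ (splitEntry (merge w) t) ≡ mult w t
      mult-split-merge {t} lo hi = +-cancelʳ-≡ (bit (flag (merge w) t)) _ _ (begin
        proj₁ (splitEntry (merge w) t) + bit (flag (merge w) t)
          ≡⟨ splitMult-+ (merge w) t (bit-flag≤mult (merge w) isKKOver-merge t) ⟩
        mult (merge w) t + K * bit (flag (merge w) (K * t))
          ≡⟨ cong₂ (λ e b → proj₁ e + K * bit b) (entry-tabulate (mergeEntry w) lo hi) (flag-merge-multiple lo) ⟩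
        proj₁ (mergeEntry w t) + K * bit (flag w t)
          ≡⟨ mergeMult-+ w t (K*bit-flag≤mult w valid t) ⟩
        mult w t + bit (mergedFlag w t)
          ≡⟨ cong (λ b → mult w t + bit b) (flag-merge lo hi) ⟨
        mult w t + bit (flag (merge w) t) ∎)
        where open ≡-Reasoning

module Counted (k ℓ m n : ℕ) where

  open Bijection k n

  CountedByO CountedByP : Config → Set
  CountedByO v = T (isKKOver K v ∧ hasStats ℓ m n v)
  CountedByP w = T (isKPart K w ∧ hasStats ℓ (m + k * ℓ) n w)

  split-counted : ∀ v → CountedByO v → split v ∈ configs n n × CountedByP (split v)
  split-counted v counted with Equivalence.to T-∧ counted
  ... | valid , stats with Equivalence.to (T-hasStats ℓ m n v) stats
  ... | weight≡n , parts≡m , over≡ℓ =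
    ∈-configs n 0 (split v) (≤-reflexive weight′≡n) ,
    Equivalence.from T-∧ (isKPart-split , Equivalence.from (T-hasStats ℓ (m + k * ℓ) n (split v))
      (weight′≡n ,
       trans numParts-split (cong₂ (λ p o → p + k * o) parts≡m over≡ℓ) ,
       trans numOver-split over≡ℓ))
    where
    open SplitProperties v valid
    weight′≡n = trans weight-split weight≡n

  merge-counted : ∀ w → CountedByP w → merge w ∈ configs n n × CountedByO (merge w)
  merge-counted w counted with Equivalence.to T-∧ counted
  ... | valid , stats with Equivalence.to (T-hasStats ℓ (m + k * ℓ) n w) stats
  ... | weight≡n , parts≡m+kℓ , over≡ℓ =
    ∈-configs n 0 (merge w) (≤-reflexive weight′≡n) ,
    Equivalence.from T-∧ (isKKOver-merge , Equivalence.from (T-hasStats ℓ m n (merge w))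
      (weight′≡n , +-cancelʳ-≡ (k * ℓ) _ _ parts′ , trans numOver-merge over≡ℓ))
    where
    open MergeProperties w valid (≤-reflexive weight≡n)
    weight′≡n = trans weight-merge weight≡n
    parts′ : numParts (merge w) + k * ℓ ≡ m + k * ℓ
    parts′ = trans (cong (λ o → numParts (merge w) + k * o) (sym over≡ℓ)) (trans numParts-merge parts≡m+kℓ)

  merge∘split : ∀ v → CountedByO v → merge (split v) ≡ v
  merge∘split v counted = SplitProperties.merge-split v (proj₁ (Equivalence.to T-∧ counted))

  split∘merge : ∀ w → CountedByP w → split (merge w) ≡ w
  split∘merge w counted with Equivalence.to T-∧ counted
  ... | valid , stats with Equivalence.to (T-hasStats ℓ (m + k * ℓ) n w) stats
  ... | weight≡n , _ = MergeProperties.split-merge w valid (≤-reflexive weight≡n)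

theorem1p1 : (k : ℕ) → 0 < k → (ℓ m n : ℕ) →
    O k ℓ m n ≡ P k ℓ (m + (k ∸ 1) * ℓ) n
theorem1p1 (suc k) _ ℓ m n =
  length-filter-bijection (T? ∘ _) (T? ∘ _) split merge (configs-unique n n)
    (λ {v} _ → split-counted v) (λ {w} _ → merge-counted w)
    (λ {v} _ → merge∘split v) (λ {w} _ → split∘merge w)
  where
  open Bijection k n using (split; merge)
  open Counted k ℓ m n
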